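{- If there is a term $t$ with $x_1:P_1,\dots,x_n:P_n\vdash t:Q$ derivable in $\lambda^{\mathrm{PRK}}$, then $\lfloor P_1\rfloor,\dots,\lfloor P_n\rfloor\vdash\lfloor Q\rfloor$ is derivable in the classical second-order natural deduction system $\mathrm{NK}$, where $\lfloor A^{\oplus}\rfloor=\lfloor A^{+}\rfloor=A$ and $\lfloor A^{\ominus}\rfloor=\lfloor A^{ - }\rfloor=\neg A$.
   Context: Pure types: given a denumerable set of type variables $\alpha,\beta,\dots$, pure types are $A,B ::= \alpha \mid A\wedge B \mid A\vee B \mid A\to B \mid A\ltimes B \mid \neg A \mid \forall\alpha.A \mid \exists\alpha.A$ (quantifiers bind $\alpha$; $A[\alpha:=B]$ capture-avoiding substitution; $\mathrm{ftv}$ free type variables). Types are $P,Q ::= A^{+}\mid A^{ - }\mid A^{\oplus}\mid A^{\ominus}$ (modes only at the root); $B^{\oplus}[\alpha:=A]$ means $(B[\alpha:=A])^{\oplus}$, etc. Terms ($\varepsilon\in\{+,-\}$, $i\in\{1,2\}$): $t,s,u ::= x \mid t \mathbin{\#}^{P} s \mid \lambda^{\varepsilon}_{\circ}(x:P).t \mid t \circ^{\varepsilon} s \mid \langle t,s\rangle^{\varepsilon} \mid \pi^{\varepsilon}_i(t) \mid \mathrm{in}^{\varepsilon}_i(t) \mid \mathrm{case}^{\varepsilon}\, t\,[x:P.\,s \mid y:Q.\,u] \mid \lambda^{\varepsilon}(x:P).t \mid t @^{\varepsilon} s \mid \langle\!\langle t,s\rangle\!\rangle^{\varepsilon} \mid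 \mathrm{colam}^{\varepsilon}\, t\,[x:P,y:Q.\,s] \mid \neg\mathrm{I}^{\varepsilon}(t) \mid \neg\mathrm{E}^{\varepsilon}(t) \mid \Lambda^{\varepsilon}\alpha.t \mid t[A]^{\varepsilon} \mid \langle A,t\rangle^{\varepsilon} \mid \mathrm{open}^{\varepsilon}\, t \text{ as } (\alpha,x:P) \text{ in } s$, with evident binders, up to $\alpha$-renaming. A typing context $\Gamma$ is a finite assignment $x_1:P_1,\dots,x_n:P_n$. Typing judgments $\Gamma\vdash t:P$ of $\lambda^{\mathrm{PRK}}$ are derived by the rules: (Ax) $\Gamma,x:P\vdash x:P$. (Abs) if $\Gamma\vdash t:A^{+}$ and $\Gamma\vdash s:A^{ - }$ then $\Gamma\vdash t\mathbin{\#}^{P}s:P$ for any $P$. (Weak) if $\Gamma,x:A^{\ominus}\vdash t:A^{+}$ then $\Gamma\vdash\lambda^{+}_{\circ}(x:A^{\ominus}).t:A^{\oplus}$; if $\Gamma,x:A^{\oplus}\vdash t:A^{ - }$ then $\Gamma\vdash\lambda^{ - }_{\circ}(x:A^{\oplus}).t:A^{\ominus}$; if $\Gamma\vdash t:A^{\oplus}$, $\Gamma\vdash s:A^{\ominus}$ then $\Gamma\vdash t\circ^{+}s:A^{+}$; if $\Gamma\vdash t:A^{\ominus}$, $\Gamma\vdash s:A^{\oplus}$ then $\Gamma\vdash t\circ^{ - }s:A^{ - }$. (Pairs) from $t:A^{\oplus}$, $s:B^{\oplus}$ infer $\langle t,s\rangle^{+}:(A\wedge B)^{+}$; from $t:A^{\ominus}$,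 $s:B^{\ominus}$ infer $\langle t,s\rangle^{ - }:(A\vee B)^{ - }$; from $t:(A_1\wedge A_2)^{+}$ infer $\pi^{+}_i(t):A_i^{\oplus}$; from $t:(A_1\vee A_2)^{ - }$ infer $\pi^{ - }_i(t):A_i^{\ominus}$ (same $\Gamma$ throughout). (Injections) from $t:A_i^{\oplus}$ infer $\mathrm{in}^{+}_i(t):(A_1\vee A_2)^{+}$; from $t:A_i^{\ominus}$ infer $\mathrm{in}^{ - }_i(t):(A_1\wedge A_2)^{ - }$; if $\Gamma\vdash t:(A\vee B)^{+}$, $\Gamma,x:A^{\oplus}\vdash s:P$, $\Gamma,y:B^{\oplus}\vdash u:P$ then $\Gamma\vdash\mathrm{case}^{+}t[x:A^{\oplus}.s\mid y:B^{\oplus}.u]:P$; if $\Gamma\vdash t:(A\wedge B)^{ - }$, $\Gamma,x:A^{\ominus}\vdash s:P$, $\Gamma,y:B^{\ominus}\vdash u:P$ then $\Gamma\vdash\mathrm{case}^{ - }t[x:A^{\ominus}.s\mid y:B^{\ominus}.u]:P$. (Implication/co-implication) if $\Gamma,x:A^{\oplus}\vdash t:B^{\oplus}$ then $\Gamma\vdash\lambda^{+}(x:A^{\oplus}).t:(A\to B)^{+}$; if $\Gamma,x:A^{\ominus}\vdash t:B^{\ominus}$ then $\Gamma\vdash\lambda^{ - }(x:A^{\ominus}).t:(A\ltimes B)^{ - }$; from $t:(A\to B)^{+}$, $s:A^{\oplus}$ infer $t@^{+}s:B^{\oplus}$; from $t:(A\ltimes B)^{ - }$, $s:A^{\ominus}$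 infer $t@^{ - }s:B^{\ominus}$; from $t:A^{\ominus}$, $s:B^{\oplus}$ infer $\langle\!\langle t,s\rangle\!\rangle^{+}:(A\ltimes B)^{+}$; from $t:A^{\oplus}$, $s:B^{\ominus}$ infer $\langle\!\langle t,s\rangle\!\rangle^{ - }:(A\to B)^{ - }$; if $\Gamma\vdash t:(A\ltimes B)^{+}$ and $\Gamma,x:A^{\ominus},y:B^{\oplus}\vdash s:P$ then $\Gamma\vdash\mathrm{colam}^{+}t[x:A^{\ominus},y:B^{\oplus}.s]:P$; if $\Gamma\vdash t:(A\to B)^{ - }$ and $\Gamma,x:A^{\oplus},y:B^{\ominus}\vdash s:P$ then $\Gamma\vdash\mathrm{colam}^{ - }t[x:A^{\oplus},y:B^{\ominus}.s]:P$. (Negation) from $t:A^{\ominus}$ infer $\neg\mathrm{I}^{+}(t):(\neg A)^{+}$; from $t:A^{\oplus}$ infer $\neg\mathrm{I}^{ - }(t):(\neg A)^{ - }$; from $t:(\neg A)^{+}$ infer $\neg\mathrm{E}^{+}(t):A^{\ominus}$; from $t:(\neg A)^{ - }$ infer $\neg\mathrm{E}^{ - }(t):A^{\oplus}$. (Quantifiers) if $\Gamma\vdash t:A^{\oplus}$, $\alpha\notin\mathrm{ftv}(\Gamma)$ then $\Gamma\vdash\Lambda^{+}\alpha.t:(\forall\alpha.A)^{+}$; if $\Gamma\vdash t:A^{\ominus}$, $\alpha\notin\mathrm{ftv}(\Gamma)$ then $\Gamma\vdash\Lambda^{ - }\alpha.t:(\exists\alpha.A)^{ - }$; from $t:(\forall\alpha.B)^{+}$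 infer $t[A]^{+}:B^{\oplus}[\alpha:=A]$; from $t:(\exists\alpha.B)^{ - }$ infer $t[A]^{ - }:B^{\ominus}[\alpha:=A]$; from $t:B^{\oplus}[\alpha:=A]$ infer $\langle A,t\rangle^{+}:(\exists\alpha.B)^{+}$; from $t:B^{\ominus}[\alpha:=A]$ infer $\langle A,t\rangle^{ - }:(\forall\alpha.B)^{ - }$; if $\Gamma\vdash t:(\exists\alpha.A)^{+}$, $\Gamma,x:A^{\oplus}\vdash s:P$, $\alpha\notin\mathrm{ftv}(\Gamma,P)$ then $\Gamma\vdash\mathrm{open}^{+}t\text{ as }(\alpha,x:A^{\oplus})\text{ in }s:P$; if $\Gamma\vdash t:(\forall\alpha.A)^{ - }$, $\Gamma,x:A^{\ominus}\vdash s:P$, $\alpha\notin\mathrm{ftv}(\Gamma,P)$ then $\Gamma\vdash\mathrm{open}^{ - }t\text{ as }(\alpha,x:A^{\ominus})\text{ in }s:P$. $\mathrm{NK}$: formulas $A ::= \alpha\mid\bot\mid A\wedge A\mid A\vee A\mid A\to A\mid A\ltimes A\mid\neg A\mid\forall\alpha.A\mid\exists\alpha.A$ (second-order propositional quantification; pure types are formulas); sequents $\Gamma\vdash A$; rules: axiom $\Gamma,A\vdash A$; $\bot$-elimination; standard natural-deduction introduction/elimination rules for $\wedge,\vee,\to$; $\neg$-introduction ($\Gamma,A\vdash\bot$ gives $\Gamma\vdash\neg A$) and $\neg$-elimination ($\Gamma\vdash\neg A$, $\Gamma\vdash A$ give $\Gamma\vdash\bot$); $\ltimes$-introduction ($\Gamma\vdash\neg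 A$, $\Gamma\vdash B$ give $\Gamma\vdash A\ltimes B$) and $\ltimes$-elimination ($\Gamma\vdash A\ltimes B$ and $\Gamma,\neg A,B\vdash C$ give $\Gamma\vdash C$); $\forall$-introduction (from $\Gamma\vdash A$ with $\alpha\notin\mathrm{ftv}(\Gamma)$ infer $\Gamma\vdash\forall\alpha.A$), $\forall$-elimination (from $\Gamma\vdash\forall\alpha.B$ infer $\Gamma\vdash B[\alpha:=A]$ for any formula $A$), $\exists$-introduction (from $\Gamma\vdash B[\alpha:=A]$ infer $\Gamma\vdash\exists\alpha.B$), $\exists$-elimination (from $\Gamma\vdash\exists\alpha.A$ and $\Gamma,A\vdash B$ with $\alpha\notin\mathrm{ftv}(\Gamma,B)$ infer $\Gamma\vdash B$); and excluded middle $\Gamma\vdash A\vee\neg A$. -}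

module Defs where

open import Data.Nat using (ℕ; zero; suc)
open import Data.List using (List; []; _∷_; map)
open import Data.List.Membership.Propositional using (_∈_)

-- Conventions: type variables and term variables are de Bruijn indices
-- (so "up to alpha-renaming" and capture-avoiding substitution are built in).
-- A quantifier binds index 0.  The side condition  α ∉ ftv(Γ)  (resp. ftv(Γ,P))
-- is rendered in the standard de Bruijn way: the premise is stated in the
-- shifted context ↑Γ (and with shifted P), so Γ cannot mention the bound α.

infixr 6 _∧_ _∨_
infixr 5 _⇒_ _⋉_

data Ty : Set where
  tvar : ℕ → Ty
  _∧_ _∨_ _⇒_ _⋉_ : Ty → Ty → Ty
  ¬ᵗ : Ty → Ty
  ∀ᵗ ∃ᵗ : Ty → Ty

extR : (ℕ → ℕ) → ℕ → ℕ
extR ρ zero    = zero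
extR ρ (suc n) = suc (ρ n)

renTy : (ℕ → ℕ) → Ty → Ty
renTy ρ (tvar n) = tvar (ρ n)
renTy ρ (A ∧ B)  = renTy ρ A ∧ renTy ρ B
renTy ρ (A ∨ B)  = renTy ρ A ∨ renTy ρ B
renTy ρ (A ⇒ B)  = renTy ρ A ⇒ renTy ρ B
renTy ρ (A ⋉ B)  = renTy ρ A ⋉ renTy ρ B
renTy ρ (¬ᵗ A)   = ¬ᵗ (renTy ρ A)
renTy ρ (∀ᵗ A)   = ∀ᵗ (renTy (extR ρ) A)
renTy ρ (∃ᵗ A)   = ∃ᵗ (renTy (extR ρ) A)

extS : (ℕ → Ty) → ℕ → Ty
extS σ zero    = tvar zero
extS σ (suc n) = renTy suc (σ n)

subTy : (ℕ → Ty) → Ty → Ty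
subTy σ (tvar n) = σ n
subTy σ (A ∧ B)  = subTy σ A ∧ subTy σ B
subTy σ (A ∨ B)  = subTy σ A ∨ subTy σ B
subTy σ (A ⇒ B)  = subTy σ A ⇒ subTy σ B
subTy σ (A ⋉ B)  = subTy σ A ⋉ subTy σ B
subTy σ (¬ᵗ A)   = ¬ᵗ (subTy σ A)
subTy σ (∀ᵗ A)   = ∀ᵗ (subTy (extS σ) A)
subTy σ (∃ᵗ A)   = ∃ᵗ (subTy (extS σ) A)

sub0 : Ty → ℕ → Ty
sub0 A zero    = A
sub0 A (suc n) = tvar n

_[_]ᵗ : Ty → Ty → Ty
B [ A ]ᵗ = subTy (sub0 A) B

data Mode : Set where
  ⁺ ⁻ ⊕ ⊖ : Mode

record Type : Set where
  constructor _^_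
  field
    ty   : Ty
    mode : Mode
open Type public

↑T : Type → Type
↑T (A ^ m) = renTy suc A ^ m

↑Γ : List Type → List Type
↑Γ = map ↑T

data Sign : Set where
  pos neg : Sign

data Idx : Set where
  i₁ i₂ : Idx

pick : Idx → Ty → Ty → Ty
pick i₁ A B = A
pick i₂ A B = B

data Tm : Set where
  var    : ℕ → Tm
  abs    : Tm → Type → Tm → Tm
  lamW   : Sign → Type → Tm → Tm
  appW   : Sign → Tm → Tm → Tm
  pair   : Sign → Tm → Tm → Tm
  proj   : Sign → Idx → Tm → Tm
  inj    : Sign → Idx → Tm → Tm
  case   : Sign → Tm → Type → Tm → Type → Tm → Tm
  lam    : Sign → Type → Tm → Tm
  app    : Sign → Tm → Tm → Tm
  cpair  : Sign → Tm → Tm → Tm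
  colam  : Sign → Tm → Type → Type → Tm → Tm   -- colam^ε t [x:P,y:Q.s]  (y = index 0, x = index 1)
  negI   : Sign → Tm → Tm
  negE   : Sign → Tm → Tm
  tlam   : Sign → Tm → Tm
  tapp   : Sign → Tm → Ty → Tm
  pack   : Sign → Ty → Tm → Tm
  open'  : Sign → Tm → Type → Tm → Tm

data _∋_∶_ : List Type → ℕ → Type → Set where
  here  : ∀ {Γ P} → (P ∷ Γ) ∋ zero ∶ P
  there : ∀ {Γ P Q n} → Γ ∋ n ∶ P → (Q ∷ Γ) ∋ suc n ∶ P

infix 4 _⊢_∶_

data _⊢_∶_ : List Type → Tm → Type → Set where
  ax     : ∀ {Γ n P} → Γ ∋ n ∶ P → Γ ⊢ var n ∶ P
  absr   : ∀ {Γ A t s P} → Γ ⊢ t ∶ A ^ ⁺ → Γ ⊢ s ∶ A ^ ⁻ → Γ ⊢ abs t P s ∶ P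
  lamW⁺  : ∀ {Γ A t} → (A ^ ⊖) ∷ Γ ⊢ t ∶ A ^ ⁺ → Γ ⊢ lamW pos (A ^ ⊖) t ∶ A ^ ⊕
  lamW⁻  : ∀ {Γ A t} → (A ^ ⊕) ∷ Γ ⊢ t ∶ A ^ ⁻ → Γ ⊢ lamW neg (A ^ ⊕) t ∶ A ^ ⊖
  appW⁺  : ∀ {Γ A t s} → Γ ⊢ t ∶ A ^ ⊕ → Γ ⊢ s ∶ A ^ ⊖ → Γ ⊢ appW pos t s ∶ A ^ ⁺
  appW⁻  : ∀ {Γ A t s} → Γ ⊢ t ∶ A ^ ⊖ → Γ ⊢ s ∶ A ^ ⊕ → Γ ⊢ appW neg t s ∶ A ^ ⁻
  pair⁺  : ∀ {Γ A B t s} → Γ ⊢ t ∶ A ^ ⊕ → Γ ⊢ s ∶ B ^ ⊕ → Γ ⊢ pair pos t s ∶ (A ∧ B) ^ ⁺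
  pair⁻  : ∀ {Γ A B t s} → Γ ⊢ t ∶ A ^ ⊖ → Γ ⊢ s ∶ B ^ ⊖ → Γ ⊢ pair neg t s ∶ (A ∨ B) ^ ⁻
  proj⁺  : ∀ {Γ A₁ A₂ t} (i : Idx) → Γ ⊢ t ∶ (A₁ ∧ A₂) ^ ⁺ → Γ ⊢ proj pos i t ∶ pick i A₁ A₂ ^ ⊕
  proj⁻  : ∀ {Γ A₁ A₂ t} (i : Idx) → Γ ⊢ t ∶ (A₁ ∨ A₂) ^ ⁻ → Γ ⊢ proj neg i t ∶ pick i A₁ A₂ ^ ⊖
  inj⁺   : ∀ {Γ A₁ A₂ t} (i : Idx) → Γ ⊢ t ∶ pick i A₁ A₂ ^ ⊕ → Γ ⊢ inj pos i t ∶ (A₁ ∨ A₂) ^ ⁺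
  inj⁻   : ∀ {Γ A₁ A₂ t} (i : Idx) → Γ ⊢ t ∶ pick i A₁ A₂ ^ ⊖ → Γ ⊢ inj neg i t ∶ (A₁ ∧ A₂) ^ ⁻
  case⁺  : ∀ {Γ A B t s u P} → Γ ⊢ t ∶ (A ∨ B) ^ ⁺ → (A ^ ⊕) ∷ Γ ⊢ s ∶ P → (B ^ ⊕) ∷ Γ ⊢ u ∶ P
         → Γ ⊢ case pos t (A ^ ⊕) s (B ^ ⊕) u ∶ P
  case⁻  : ∀ {Γ A B t s u P} → Γ ⊢ t ∶ (A ∧ B) ^ ⁻ → (A ^ ⊖) ∷ Γ ⊢ s ∶ P → (B ^ ⊖) ∷ Γ ⊢ u ∶ P
         → Γ ⊢ case neg t (A ^ ⊖) s (B ^ ⊖) u ∶ P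
  lam⁺   : ∀ {Γ A B t} → (A ^ ⊕) ∷ Γ ⊢ t ∶ B ^ ⊕ → Γ ⊢ lam pos (A ^ ⊕) t ∶ (A ⇒ B) ^ ⁺
  lam⁻   : ∀ {Γ A B t} → (A ^ ⊖) ∷ Γ ⊢ t ∶ B ^ ⊖ → Γ ⊢ lam neg (A ^ ⊖) t ∶ (A ⋉ B) ^ ⁻
  app⁺   : ∀ {Γ A B t s} → Γ ⊢ t ∶ (A ⇒ B) ^ ⁺ → Γ ⊢ s ∶ A ^ ⊕ → Γ ⊢ app pos t s ∶ B ^ ⊕
  app⁻   : ∀ {Γ A B t s} → Γ ⊢ t ∶ (A ⋉ B) ^ ⁻ → Γ ⊢ s ∶ A ^ ⊖ → Γ ⊢ app neg t s ∶ B ^ ⊖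
  cpair⁺ : ∀ {Γ A B t s} → Γ ⊢ t ∶ A ^ ⊖ → Γ ⊢ s ∶ B ^ ⊕ → Γ ⊢ cpair pos t s ∶ (A ⋉ B) ^ ⁺
  cpair⁻ : ∀ {Γ A B t s} → Γ ⊢ t ∶ A ^ ⊕ → Γ ⊢ s ∶ B ^ ⊖ → Γ ⊢ cpair neg t s ∶ (A ⇒ B) ^ ⁻
  colam⁺ : ∀ {Γ A B t s P} → Γ ⊢ t ∶ (A ⋉ B) ^ ⁺ → (B ^ ⊕) ∷ (A ^ ⊖) ∷ Γ ⊢ s ∶ P
         → Γ ⊢ colam pos t (A ^ ⊖) (B ^ ⊕) s ∶ P
  colam⁻ : ∀ {Γ A B t s P} → Γ ⊢ t ∶ (A ⇒ B) ^ ⁻ → (B ^ ⊖) ∷ (A ^ ⊕) ∷ Γ ⊢ s ∶ P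
         → Γ ⊢ colam neg t (A ^ ⊕) (B ^ ⊖) s ∶ P
  negI⁺  : ∀ {Γ A t} → Γ ⊢ t ∶ A ^ ⊖ → Γ ⊢ negI pos t ∶ (¬ᵗ A) ^ ⁺
  negI⁻  : ∀ {Γ A t} → Γ ⊢ t ∶ A ^ ⊕ → Γ ⊢ negI neg t ∶ (¬ᵗ A) ^ ⁻
  negE⁺  : ∀ {Γ A t} → Γ ⊢ t ∶ (¬ᵗ A) ^ ⁺ → Γ ⊢ negE pos t ∶ A ^ ⊖
  negE⁻  : ∀ {Γ A t} → Γ ⊢ t ∶ (¬ᵗ A) ^ ⁻ → Γ ⊢ negE neg t ∶ A ^ ⊕
  tlam⁺  : ∀ {Γ A t} → ↑Γ Γ ⊢ t ∶ A ^ ⊕ → Γ ⊢ tlam pos t ∶ (∀ᵗ A) ^ ⁺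
  tlam⁻  : ∀ {Γ A t} → ↑Γ Γ ⊢ t ∶ A ^ ⊖ → Γ ⊢ tlam neg t ∶ (∃ᵗ A) ^ ⁻
  tapp⁺  : ∀ {Γ B t} (A : Ty) → Γ ⊢ t ∶ (∀ᵗ B) ^ ⁺ → Γ ⊢ tapp pos t A ∶ (B [ A ]ᵗ) ^ ⊕
  tapp⁻  : ∀ {Γ B t} (A : Ty) → Γ ⊢ t ∶ (∃ᵗ B) ^ ⁻ → Γ ⊢ tapp neg t A ∶ (B [ A ]ᵗ) ^ ⊖
  pack⁺  : ∀ {Γ B t} (A : Ty) → Γ ⊢ t ∶ (B [ A ]ᵗ) ^ ⊕ → Γ ⊢ pack pos A t ∶ (∃ᵗ B) ^ ⁺
  pack⁻  : ∀ {Γ B t} (A : Ty) → Γ ⊢ t ∶ (B [ A ]ᵗ) ^ ⊖ → Γ ⊢ pack neg A t ∶ (∀ᵗ B) ^ ⁻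
  open⁺  : ∀ {Γ A t s P} → Γ ⊢ t ∶ (∃ᵗ A) ^ ⁺ → (A ^ ⊕) ∷ ↑Γ Γ ⊢ s ∶ ↑T P
         → Γ ⊢ open' pos t (A ^ ⊕) s ∶ P
  open⁻  : ∀ {Γ A t s P} → Γ ⊢ t ∶ (∀ᵗ A) ^ ⁻ → (A ^ ⊖) ∷ ↑Γ Γ ⊢ s ∶ ↑T P
         → Γ ⊢ open' neg t (A ^ ⊖) s ∶ P

data Fm : Set where
  fvar : ℕ → Fm
  ⊥ᶠ   : Fm
  _∧ᶠ_ _∨ᶠ_ _⇒ᶠ_ _⋉ᶠ_ : Fm → Fm → Fm
  ¬ᶠ   : Fm → Fm
  ∀ᶠ ∃ᶠ : Fm → Fm

renFm : (ℕ → ℕ) → Fm → Fm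
renFm ρ (fvar n)  = fvar (ρ n)
renFm ρ ⊥ᶠ        = ⊥ᶠ
renFm ρ (A ∧ᶠ B)  = renFm ρ A ∧ᶠ renFm ρ B
renFm ρ (A ∨ᶠ B)  = renFm ρ A ∨ᶠ renFm ρ B
renFm ρ (A ⇒ᶠ B)  = renFm ρ A ⇒ᶠ renFm ρ B
renFm ρ (A ⋉ᶠ B)  = renFm ρ A ⋉ᶠ renFm ρ B
renFm ρ (¬ᶠ A)    = ¬ᶠ (renFm ρ A)
renFm ρ (∀ᶠ A)    = ∀ᶠ (renFm (extR ρ) A)
renFm ρ (∃ᶠ A)    = ∃ᶠ (renFm (extR ρ) A)

extSᶠ : (ℕ → Fm) → ℕ → Fm
extSᶠ σ zero    = fvar zero
extSᶠ σ (suc n) = renFm suc (σ n)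

subFm : (ℕ → Fm) → Fm → Fm
subFm σ (fvar n)  = σ n
subFm σ ⊥ᶠ        = ⊥ᶠ
subFm σ (A ∧ᶠ B)  = subFm σ A ∧ᶠ subFm σ B
subFm σ (A ∨ᶠ B)  = subFm σ A ∨ᶠ subFm σ B
subFm σ (A ⇒ᶠ B)  = subFm σ A ⇒ᶠ subFm σ B
subFm σ (A ⋉ᶠ B)  = subFm σ A ⋉ᶠ subFm σ B
subFm σ (¬ᶠ A)    = ¬ᶠ (subFm σ A)
subFm σ (∀ᶠ A)    = ∀ᶠ (subFm (extSᶠ σ) A)
subFm σ (∃ᶠ A)    = ∃ᶠ (subFm (extSᶠ σ) A)

sub0ᶠ : Fm → ℕ → Fm
sub0ᶠ A zero    = A
sub0ᶠ A (suc n) = fvar n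

_[_]ᶠ : Fm → Fm → Fm
B [ A ]ᶠ = subFm (sub0ᶠ A) B

↑Δ : List Fm → List Fm
↑Δ = map (renFm suc)

infix 4 _⊢NK_

data _⊢NK_ : List Fm → Fm → Set where
  axm  : ∀ {Δ A} → A ∈ Δ → Δ ⊢NK A
  ⊥E   : ∀ {Δ A} → Δ ⊢NK ⊥ᶠ → Δ ⊢NK A
  ∧I   : ∀ {Δ A B} → Δ ⊢NK A → Δ ⊢NK B → Δ ⊢NK A ∧ᶠ B
  ∧E₁  : ∀ {Δ A B} → Δ ⊢NK A ∧ᶠ B → Δ ⊢NK A
  ∧E₂  : ∀ {Δ A B} → Δ ⊢NK A ∧ᶠ B → Δ ⊢NK B
  ∨I₁  : ∀ {Δ A B} → Δ ⊢NK A → Δ ⊢NK A ∨ᶠ B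
  ∨I₂  : ∀ {Δ A B} → Δ ⊢NK B → Δ ⊢NK A ∨ᶠ B
  ∨E   : ∀ {Δ A B C} → Δ ⊢NK A ∨ᶠ B → A ∷ Δ ⊢NK C → B ∷ Δ ⊢NK C → Δ ⊢NK C
  ⇒I   : ∀ {Δ A B} → A ∷ Δ ⊢NK B → Δ ⊢NK A ⇒ᶠ B
  ⇒E   : ∀ {Δ A B} → Δ ⊢NK A ⇒ᶠ B → Δ ⊢NK A → Δ ⊢NK B
  ¬I   : ∀ {Δ A} → A ∷ Δ ⊢NK ⊥ᶠ → Δ ⊢NK ¬ᶠ A
  ¬E   : ∀ {Δ A} → Δ ⊢NK ¬ᶠ A → Δ ⊢NK A → Δ ⊢NK ⊥ᶠ
  ⋉I   : ∀ {Δ A B} → Δ ⊢NK ¬ᶠ A → Δ ⊢NK B → Δ ⊢NK A ⋉ᶠ B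
  ⋉E   : ∀ {Δ A B C} → Δ ⊢NK A ⋉ᶠ B → B ∷ ¬ᶠ A ∷ Δ ⊢NK C → Δ ⊢NK C
  ∀I   : ∀ {Δ A} → ↑Δ Δ ⊢NK A → Δ ⊢NK ∀ᶠ A
  ∀E   : ∀ {Δ B} (A : Fm) → Δ ⊢NK ∀ᶠ B → Δ ⊢NK B [ A ]ᶠ
  ∃I   : ∀ {Δ B} (A : Fm) → Δ ⊢NK B [ A ]ᶠ → Δ ⊢NK ∃ᶠ B
  ∃E   : ∀ {Δ A B} → Δ ⊢NK ∃ᶠ A → A ∷ ↑Δ Δ ⊢NK renFm suc B → Δ ⊢NK B
  em   : ∀ {Δ A} → Δ ⊢NK A ∨ᶠ ¬ᶠ A

emb : Ty → Fm
emb (tvar n) = fvar n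
emb (A ∧ B)  = emb A ∧ᶠ emb B
emb (A ∨ B)  = emb A ∨ᶠ emb B
emb (A ⇒ B)  = emb A ⇒ᶠ emb B
emb (A ⋉ B)  = emb A ⋉ᶠ emb B
emb (¬ᵗ A)   = ¬ᶠ (emb A)
emb (∀ᵗ A)   = ∀ᶠ (emb A)
emb (∃ᵗ A)   = ∃ᶠ (emb A)

⌊_⌋ : Type → Fm
⌊ A ^ ⁺ ⌋ = emb A
⌊ A ^ ⊕ ⌋ = emb A
⌊ A ^ ⁻ ⌋ = ¬ᶠ (emb A)
⌊ A ^ ⊖ ⌋ = ¬ᶠ (emb A)

-- Classical reading of the modes: A⁺ and A⊕ mean that A holds, A⁻ and A⊖ that it is refuted.
-- Under this reading every λ^PRK rule is a derived NK rule: the rules for the positive modes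
-- are the ordinary intuitionistic ones, those for the negative modes are their contrapositives,
-- and the eliminations of refuted ∧, →, ∀ (case⁻, colam⁻, open⁻) and the weak abstraction λ⁺∘
-- need excluded middle, as the dualities ¬(A ∧ B) ⊢ ¬A ∨ ¬B, ¬(A → B) ⊢ A ∧ ¬B,
-- ¬∀α.A ⊢ ∃α.¬A and consequentia mirabilis (¬A → A) ⊢ A.
module Submission where

open import Defs
open import Data.List using (List; []; _∷_; map)
open import Data.List.Membership.Propositional using (_∈_)
open import Data.List.Properties using (map-∘; map-cong)
open import Data.List.Relation.Binary.Subset.Propositional using (_⊆_)
open import Data.List.Relation.Binary.Subset.Propositional.Properties using (map⁺; ∷⁺ʳ)
open import Data.List.Relation.Unary.Any using (here; there)
open import Data.Nat using (zero; suc)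
open import Relation.Binary.PropositionalEquality using (_≡_; refl; sym; trans; cong; cong₂; subst; subst₂)

emb-renTy : ∀ ρ A → emb (renTy ρ A) ≡ renFm ρ (emb A)
emb-renTy ρ (tvar n) = refl
emb-renTy ρ (A ∧ B)  = cong₂ _∧ᶠ_ (emb-renTy ρ A) (emb-renTy ρ B)
emb-renTy ρ (A ∨ B)  = cong₂ _∨ᶠ_ (emb-renTy ρ A) (emb-renTy ρ B)
emb-renTy ρ (A ⇒ B)  = cong₂ _⇒ᶠ_ (emb-renTy ρ A) (emb-renTy ρ B)
emb-renTy ρ (A ⋉ B)  = cong₂ _⋉ᶠ_ (emb-renTy ρ A) (emb-renTy ρ B)
emb-renTy ρ (¬ᵗ A)   = cong ¬ᶠ (emb-renTy ρ A)
emb-renTy ρ (∀ᵗ A)   = cong ∀ᶠ (emb-renTy (extR ρ) A)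
emb-renTy ρ (∃ᵗ A)   = cong ∃ᶠ (emb-renTy (extR ρ) A)

emb-extS : ∀ {σ τ} → (∀ n → emb (σ n) ≡ τ n) → ∀ n → emb (extS σ n) ≡ extSᶠ τ n
emb-extS σ≈τ zero    = refl
emb-extS σ≈τ (suc n) = trans (emb-renTy suc _) (cong (renFm suc) (σ≈τ n))

emb-subTy : ∀ {σ τ} → (∀ n → emb (σ n) ≡ τ n) → ∀ A → emb (subTy σ A) ≡ subFm τ (emb A)
emb-subTy σ≈τ (tvar n) = σ≈τ n
emb-subTy σ≈τ (A ∧ B)  = cong₂ _∧ᶠ_ (emb-subTy σ≈τ A) (emb-subTy σ≈τ B)
emb-subTy σ≈τ (A ∨ B)  = cong₂ _∨ᶠ_ (emb-subTy σ≈τ A) (emb-subTy σ≈τ B)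
emb-subTy σ≈τ (A ⇒ B)  = cong₂ _⇒ᶠ_ (emb-subTy σ≈τ A) (emb-subTy σ≈τ B)
emb-subTy σ≈τ (A ⋉ B)  = cong₂ _⋉ᶠ_ (emb-subTy σ≈τ A) (emb-subTy σ≈τ B)
emb-subTy σ≈τ (¬ᵗ A)   = cong ¬ᶠ (emb-subTy σ≈τ A)
emb-subTy σ≈τ (∀ᵗ A)   = cong ∀ᶠ (emb-subTy (emb-extS σ≈τ) A)
emb-subTy σ≈τ (∃ᵗ A)   = cong ∃ᶠ (emb-subTy (emb-extS σ≈τ) A)

emb-[]ᵗ : ∀ B A → emb (B [ A ]ᵗ) ≡ emb B [ emb A ]ᶠ
emb-[]ᵗ B A = emb-subTy emb-sub0 B
  where
  emb-sub0 : ∀ n → emb (sub0 A n) ≡ sub0ᶠ (emb A) n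
  emb-sub0 zero    = refl
  emb-sub0 (suc n) = refl

⌊↑T⌋ : ∀ P → ⌊ ↑T P ⌋ ≡ renFm suc ⌊ P ⌋
⌊↑T⌋ (A ^ ⁺) = emb-renTy suc A
⌊↑T⌋ (A ^ ⁻) = cong ¬ᶠ (emb-renTy suc A)
⌊↑T⌋ (A ^ ⊕) = emb-renTy suc A
⌊↑T⌋ (A ^ ⊖) = cong ¬ᶠ (emb-renTy suc A)

⌊↑Γ⌋ : ∀ Γ → map ⌊_⌋ (↑Γ Γ) ≡ ↑Δ (map ⌊_⌋ Γ)
⌊↑Γ⌋ Γ = trans (sym (map-∘ Γ)) (trans (map-cong ⌊↑T⌋ Γ) (map-∘ Γ))

extSᶠ-extR : ∀ {σ ρ τ} → (∀ n → σ (ρ n) ≡ τ n) → ∀ n → extSᶠ σ (extR ρ n) ≡ extSᶠ τ n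
extSᶠ-extR σρ≈τ zero    = refl
extSᶠ-extR σρ≈τ (suc n) = cong (renFm suc) (σρ≈τ n)

subFm-renFm : ∀ {σ ρ τ} → (∀ n → σ (ρ n) ≡ τ n) → ∀ A → subFm σ (renFm ρ A) ≡ subFm τ A
subFm-renFm σρ≈τ (fvar n) = σρ≈τ n
subFm-renFm σρ≈τ ⊥ᶠ       = refl
subFm-renFm σρ≈τ (A ∧ᶠ B) = cong₂ _∧ᶠ_ (subFm-renFm σρ≈τ A) (subFm-renFm σρ≈τ B)
subFm-renFm σρ≈τ (A ∨ᶠ B) = cong₂ _∨ᶠ_ (subFm-renFm σρ≈τ A) (subFm-renFm σρ≈τ B)
subFm-renFm σρ≈τ (A ⇒ᶠ B) = cong₂ _⇒ᶠ_ (subFm-renFm σρ≈τ A) (subFm-renFm σρ≈τ B)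
subFm-renFm σρ≈τ (A ⋉ᶠ B) = cong₂ _⋉ᶠ_ (subFm-renFm σρ≈τ A) (subFm-renFm σρ≈τ B)
subFm-renFm σρ≈τ (¬ᶠ A)   = cong ¬ᶠ (subFm-renFm σρ≈τ A)
subFm-renFm σρ≈τ (∀ᶠ A)   = cong ∀ᶠ (subFm-renFm (extSᶠ-extR σρ≈τ) A)
subFm-renFm σρ≈τ (∃ᶠ A)   = cong ∃ᶠ (subFm-renFm (extSᶠ-extR σρ≈τ) A)

extSᶠ-fvar : ∀ {σ} → (∀ n → σ n ≡ fvar n) → ∀ n → extSᶠ σ n ≡ fvar n
extSᶠ-fvar σ≈fvar zero    = refl
extSᶠ-fvar σ≈fvar (suc n) = cong (renFm suc) (σ≈fvar n)

subFm-id : ∀ {σ} → (∀ n → σ n ≡ fvar n) → ∀ A → subFm σ A ≡ A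
subFm-id σ≈fvar (fvar n) = σ≈fvar n
subFm-id σ≈fvar ⊥ᶠ       = refl
subFm-id σ≈fvar (A ∧ᶠ B) = cong₂ _∧ᶠ_ (subFm-id σ≈fvar A) (subFm-id σ≈fvar B)
subFm-id σ≈fvar (A ∨ᶠ B) = cong₂ _∨ᶠ_ (subFm-id σ≈fvar A) (subFm-id σ≈fvar B)
subFm-id σ≈fvar (A ⇒ᶠ B) = cong₂ _⇒ᶠ_ (subFm-id σ≈fvar A) (subFm-id σ≈fvar B)
subFm-id σ≈fvar (A ⋉ᶠ B) = cong₂ _⋉ᶠ_ (subFm-id σ≈fvar A) (subFm-id σ≈fvar B)
subFm-id σ≈fvar (¬ᶠ A)   = cong ¬ᶠ (subFm-id σ≈fvar A)
subFm-id σ≈fvar (∀ᶠ A)   = cong ∀ᶠ (subFm-id (extSᶠ-fvar σ≈fvar) A)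
subFm-id σ≈fvar (∃ᶠ A)   = cong ∃ᶠ (subFm-id (extSᶠ-fvar σ≈fvar) A)

renFm-extR-suc-[fvar0] : ∀ A → renFm (extR suc) A [ fvar zero ]ᶠ ≡ A
renFm-extR-suc-[fvar0] A = trans (subFm-renFm sub0-extR-suc A) (subFm-id (λ _ → refl) A)
  where
  sub0-extR-suc : ∀ n → sub0ᶠ (fvar zero) (extR suc n) ≡ fvar n
  sub0-extR-suc zero    = refl
  sub0-extR-suc (suc n) = refl

weaken : ∀ {Δ Δ′ A} → Δ ⊆ Δ′ → Δ ⊢NK A → Δ′ ⊢NK A
weaken Δ⊆Δ′ (axm A∈Δ)  = axm (Δ⊆Δ′ A∈Δ)
weaken Δ⊆Δ′ (⊥E d)     = ⊥E (weaken Δ⊆Δ′ d)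
weaken Δ⊆Δ′ (∧I d e)   = ∧I (weaken Δ⊆Δ′ d) (weaken Δ⊆Δ′ e)
weaken Δ⊆Δ′ (∧E₁ d)    = ∧E₁ (weaken Δ⊆Δ′ d)
weaken Δ⊆Δ′ (∧E₂ d)    = ∧E₂ (weaken Δ⊆Δ′ d)
weaken Δ⊆Δ′ (∨I₁ d)    = ∨I₁ (weaken Δ⊆Δ′ d)
weaken Δ⊆Δ′ (∨I₂ d)    = ∨I₂ (weaken Δ⊆Δ′ d)
weaken Δ⊆Δ′ (∨E d e f) = ∨E (weaken Δ⊆Δ′ d) (weaken (∷⁺ʳ _ Δ⊆Δ′) e) (weaken (∷⁺ʳ _ Δ⊆Δ′) f)
weaken Δ⊆Δ′ (⇒I d)     = ⇒I (weaken (∷⁺ʳ _ Δ⊆Δ′) d)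
weaken Δ⊆Δ′ (⇒E d e)   = ⇒E (weaken Δ⊆Δ′ d) (weaken Δ⊆Δ′ e)
weaken Δ⊆Δ′ (¬I d)     = ¬I (weaken (∷⁺ʳ _ Δ⊆Δ′) d)
weaken Δ⊆Δ′ (¬E d e)   = ¬E (weaken Δ⊆Δ′ d) (weaken Δ⊆Δ′ e)
weaken Δ⊆Δ′ (⋉I d e)   = ⋉I (weaken Δ⊆Δ′ d) (weaken Δ⊆Δ′ e)
weaken Δ⊆Δ′ (⋉E d e)   = ⋉E (weaken Δ⊆Δ′ d) (weaken (∷⁺ʳ _ (∷⁺ʳ _ Δ⊆Δ′)) e)
weaken Δ⊆Δ′ (∀I d)     = ∀I (weaken (map⁺ (renFm suc) Δ⊆Δ′) d)
weaken Δ⊆Δ′ (∀E A d)   = ∀E A (weaken Δ⊆Δ′ d)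
weaken Δ⊆Δ′ (∃I A d)   = ∃I A (weaken Δ⊆Δ′ d)
weaken Δ⊆Δ′ (∃E d e)   = ∃E (weaken Δ⊆Δ′ d) (weaken (∷⁺ʳ _ (map⁺ (renFm suc) Δ⊆Δ′)) e)
weaken Δ⊆Δ′ em         = em

weaken¹ : ∀ {Δ A B} → Δ ⊢NK A → B ∷ Δ ⊢NK A
weaken¹ = weaken there

weaken² : ∀ {Δ A B C} → Δ ⊢NK A → C ∷ B ∷ Δ ⊢NK A
weaken² d = weaken¹ (weaken¹ d)

weaken³ : ∀ {Δ A B C D} → Δ ⊢NK A → D ∷ C ∷ B ∷ Δ ⊢NK A
weaken³ d = weaken¹ (weaken² d)

hyp₀ : ∀ {Δ A} → A ∷ Δ ⊢NK A
hyp₀ = axm (here refl)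

hyp₁ : ∀ {Δ A B} → B ∷ A ∷ Δ ⊢NK A
hyp₁ = axm (there (here refl))

cut₂ : ∀ {Δ A B C} → Δ ⊢NK A → Δ ⊢NK B → B ∷ A ∷ Δ ⊢NK C → Δ ⊢NK C
cut₂ a b c = ⇒E (⇒E (⇒I (⇒I c)) a) b

by-contradiction : ∀ {Δ A} → ¬ᶠ A ∷ Δ ⊢NK ⊥ᶠ → Δ ⊢NK A
by-contradiction d = ∨E em hyp₀ (⊥E d)

contrapose : ∀ {Δ A B} → A ∷ Δ ⊢NK B → Δ ⊢NK ¬ᶠ B → Δ ⊢NK ¬ᶠ A
contrapose a⊢b ¬b = ¬I (¬E (weaken¹ ¬b) a⊢b)

¬¬-intro : ∀ {Δ A} → Δ ⊢NK A → Δ ⊢NK ¬ᶠ (¬ᶠ A)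
¬¬-intro a = ¬I (¬E hyp₀ (weaken¹ a))

¬¬-elim : ∀ {Δ A} → Δ ⊢NK ¬ᶠ (¬ᶠ A) → Δ ⊢NK A
¬¬-elim ¬¬a = by-contradiction (¬E (weaken¹ ¬¬a) hyp₀)

¬∧⇒∨¬ : ∀ {Δ A B} → Δ ⊢NK ¬ᶠ (A ∧ᶠ B) → Δ ⊢NK ¬ᶠ A ∨ᶠ ¬ᶠ B
¬∧⇒∨¬ ¬a∧b = by-contradiction (¬E (weaken¹ ¬a∧b)
  (∧I (by-contradiction (¬E hyp₁ (∨I₁ hyp₀))) (by-contradiction (¬E hyp₁ (∨I₂ hyp₀)))))

¬⇒⇒antecedent : ∀ {Δ A B} → Δ ⊢NK ¬ᶠ (A ⇒ᶠ B) → Δ ⊢NK A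
¬⇒⇒antecedent ¬a⇒b = by-contradiction (¬E (weaken¹ ¬a⇒b) (⇒I (⊥E (¬E hyp₁ hyp₀))))

¬⇒⇒¬consequent : ∀ {Δ A B} → Δ ⊢NK ¬ᶠ (A ⇒ᶠ B) → Δ ⊢NK ¬ᶠ B
¬⇒⇒¬consequent = contrapose (⇒I hyp₁)

¬∀⇒∃¬ : ∀ {Δ A} → Δ ⊢NK ¬ᶠ (∀ᶠ A) → Δ ⊢NK ∃ᶠ (¬ᶠ A)
¬∀⇒∃¬ {Δ} {A} ¬∀a = by-contradiction (¬E (weaken¹ ¬∀a) (∀I (by-contradiction
  (¬E hyp₁ (∃I (fvar zero) (subst (λ X → ¬ᶠ A ∷ ↑Δ (¬ᶠ (∃ᶠ (¬ᶠ A)) ∷ Δ) ⊢NK ¬ᶠ X)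
                                  (sym (renFm-extR-suc-[fvar0] A)) hyp₀))))))

¬∃-intro : ∀ {Δ A} → ↑Δ Δ ⊢NK ¬ᶠ A → Δ ⊢NK ¬ᶠ (∃ᶠ A)
¬∃-intro {Δ} {A} ¬a = ¬I (∃E hyp₀ (¬E (weaken¹ (weaken ↑Δ⊆ ¬a)) hyp₀))
  where
  ↑Δ⊆ : ↑Δ Δ ⊆ ↑Δ (∃ᶠ A ∷ Δ)
  ↑Δ⊆ = map⁺ (renFm suc) there

⊢⇒⊢NK : ∀ {Γ t Q} → Γ ⊢ t ∶ Q → map ⌊_⌋ Γ ⊢NK ⌊ Q ⌋
⊢⇒⊢NK (ax x) = axm (erase-∋ x)
  where
  erase-∋ : ∀ {Γ n P} → Γ ∋ n ∶ P → ⌊ P ⌋ ∈ map ⌊_⌋ Γ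
  erase-∋ here      = here refl
  erase-∋ (there x) = there (erase-∋ x)
⊢⇒⊢NK (absr d e)     = ⊥E (¬E (⊢⇒⊢NK e) (⊢⇒⊢NK d))
⊢⇒⊢NK (lamW⁺ d)      = by-contradiction (¬E hyp₀ (⊢⇒⊢NK d))
⊢⇒⊢NK (lamW⁻ d)      = ¬I (¬E (⊢⇒⊢NK d) hyp₀)
⊢⇒⊢NK (appW⁺ d e)    = ⊢⇒⊢NK d
⊢⇒⊢NK (appW⁻ d e)    = ⊢⇒⊢NK d
⊢⇒⊢NK (pair⁺ d e)    = ∧I (⊢⇒⊢NK d) (⊢⇒⊢NK e)
⊢⇒⊢NK (pair⁻ d e)    = ¬I (∨E hyp₀ (¬E (weaken² (⊢⇒⊢NK d)) hyp₀) (¬E (weaken² (⊢⇒⊢NK e)) hyp₀))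
⊢⇒⊢NK (proj⁺ i₁ d)   = ∧E₁ (⊢⇒⊢NK d)
⊢⇒⊢NK (proj⁺ i₂ d)   = ∧E₂ (⊢⇒⊢NK d)
⊢⇒⊢NK (proj⁻ i₁ d)   = contrapose (∨I₁ hyp₀) (⊢⇒⊢NK d)
⊢⇒⊢NK (proj⁻ i₂ d)   = contrapose (∨I₂ hyp₀) (⊢⇒⊢NK d)
⊢⇒⊢NK (inj⁺ i₁ d)    = ∨I₁ (⊢⇒⊢NK d)
⊢⇒⊢NK (inj⁺ i₂ d)    = ∨I₂ (⊢⇒⊢NK d)
⊢⇒⊢NK (inj⁻ i₁ d)    = contrapose (∧E₁ hyp₀) (⊢⇒⊢NK d)
⊢⇒⊢NK (inj⁻ i₂ d)    = contrapose (∧E₂ hyp₀) (⊢⇒⊢NK d)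
⊢⇒⊢NK (case⁺ d e f)  = ∨E (⊢⇒⊢NK d) (⊢⇒⊢NK e) (⊢⇒⊢NK f)
⊢⇒⊢NK (case⁻ d e f)  = ∨E (¬∧⇒∨¬ (⊢⇒⊢NK d)) (⊢⇒⊢NK e) (⊢⇒⊢NK f)
⊢⇒⊢NK (lam⁺ d)       = ⇒I (⊢⇒⊢NK d)
⊢⇒⊢NK (lam⁻ d)       = ¬I (⋉E hyp₀ (¬E (⇒E (weaken³ (⇒I (⊢⇒⊢NK d))) hyp₁) hyp₀))
⊢⇒⊢NK (app⁺ d e)     = ⇒E (⊢⇒⊢NK d) (⊢⇒⊢NK e)
⊢⇒⊢NK (app⁻ d e)     = contrapose (⋉I (weaken¹ (⊢⇒⊢NK e)) hyp₀) (⊢⇒⊢NK d)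
⊢⇒⊢NK (cpair⁺ d e)   = ⋉I (⊢⇒⊢NK d) (⊢⇒⊢NK e)
⊢⇒⊢NK (cpair⁻ d e)   = contrapose (⇒E hyp₀ (weaken¹ (⊢⇒⊢NK d))) (⊢⇒⊢NK e)
⊢⇒⊢NK (colam⁺ d e)   = ⋉E (⊢⇒⊢NK d) (⊢⇒⊢NK e)
⊢⇒⊢NK (colam⁻ d e)   = cut₂ (¬⇒⇒antecedent (⊢⇒⊢NK d)) (¬⇒⇒¬consequent (⊢⇒⊢NK d)) (⊢⇒⊢NK e)
⊢⇒⊢NK (negI⁺ d)      = ⊢⇒⊢NK d
⊢⇒⊢NK (negI⁻ d)      = ¬¬-intro (⊢⇒⊢NK d)
⊢⇒⊢NK (negE⁺ d)      = ⊢⇒⊢NK d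
⊢⇒⊢NK (negE⁻ d)      = ¬¬-elim (⊢⇒⊢NK d)
⊢⇒⊢NK {Γ} (tlam⁺ d)  = ∀I (subst (_⊢NK _) (⌊↑Γ⌋ Γ) (⊢⇒⊢NK d))
⊢⇒⊢NK {Γ} (tlam⁻ d)  = ¬∃-intro (subst (_⊢NK _) (⌊↑Γ⌋ Γ) (⊢⇒⊢NK d))
⊢⇒⊢NK (tapp⁺ {B = B} A d) = subst (_ ⊢NK_) (sym (emb-[]ᵗ B A)) (∀E (emb A) (⊢⇒⊢NK d))
⊢⇒⊢NK {Γ} (tapp⁻ {B = B} A d) =
  contrapose (∃I (emb A) (subst (emb (B [ A ]ᵗ) ∷ map ⌊_⌋ Γ ⊢NK_) (emb-[]ᵗ B A) hyp₀)) (⊢⇒⊢NK d)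
⊢⇒⊢NK (pack⁺ {B = B} A d) = ∃I (emb A) (subst (_ ⊢NK_) (emb-[]ᵗ B A) (⊢⇒⊢NK d))
⊢⇒⊢NK (pack⁻ {B = B} A d) =
  contrapose (subst (_ ⊢NK_) (sym (emb-[]ᵗ B A)) (∀E (emb A) hyp₀)) (⊢⇒⊢NK d)
⊢⇒⊢NK {Γ} (open⁺ {P = P} d e) =
  ∃E (⊢⇒⊢NK d) (subst₂ (λ Δ X → _ ∷ Δ ⊢NK X) (⌊↑Γ⌋ Γ) (⌊↑T⌋ P) (⊢⇒⊢NK e))
⊢⇒⊢NK {Γ} (open⁻ {P = P} d e) =
  ∃E (¬∀⇒∃¬ (⊢⇒⊢NK d)) (subst₂ (λ Δ X → _ ∷ Δ ⊢NK X) (⌊↑Γ⌋ Γ) (⌊↑T⌋ P) (⊢⇒⊢NK e))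

lemma14 : (Γ : List Type) (t : Tm) (Q : Type)
        → Γ ⊢ t ∶ Q
        → map ⌊_⌋ Γ ⊢NK ⌊ Q ⌋
lemma14 Γ t Q = ⊢⇒⊢NK
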